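{- Let $\lambda\vdash n$ with $\lambda'=(s,r)$, $s\ge r\ge1$, let $\pi$ be a minimal permutation of shape $\lambda$, and let $J=(\mu,\nu)$ be a jump partition for $\pi$ of size $\Delta=|\mu|+|\nu|<r$. Then the set of values whose positions in $\pi\circ\mu$ differ from their positions in $\pi$ is disjoint from the set of values whose positions in $\nu\circ\pi$ differ from their positions in $\pi$.
   Context: A minimal permutation of shape $\lambda$ (where $\lambda'$ denotes the conjugate of $\lambda$ and shape refers to the Robinson–Schensted correspondence) is a permutation of shape $\lambda$ with the fewest inversions; for $\lambda'=(s,r)$ these are exactly the permutations $(c_1,c_1-1,\dots,1,\,n,n-1,\dots,c_1+1)$ (one-line notation) with $(c_1,c_2)\in\{(s,r),(r,s)\}$, $n=s+r$. For such $\pi$ with blocks of lengths $c_1,c_2$: $s_t$ is the adjacent transposition $(t\ t{+}1)$; $\sigma\cdot s_t$ swaps the entries at positions $t,t+1$ of $\sigma$ and $s_t\cdot\sigma$ swaps the values $t,t+1$ in $\sigma$; products act successively (left to right for right multiplication, rightmost first for left multiplication). An inner (resp. outer) jump partition is an integer partition $\mu$ (resp. $\nu$), possibly empty, with $\ell(\mu)\le c_1$ and $\mu_1<c_2$ (resp. $\ell(\nu)\le c_1$, $\nu_1<c_2$). Actions: $\pi\circ\mu=\pi\cdot\prod_{j=1}^{\ell(\mu)}(s_{c_1-j+1}s_{c_1-j+2}\cdots s_{c_1-j+\mu_j})$ (factors in order $j=1,2,\dots$ from left to right), and $\nu\circ\pi=F_{\ell(\nu)}\cdots F_2F_1\cdot\pi$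 with $F_j=s_{c_1-j+\nu_j}\cdots s_{c_1-j+2}s_{c_1-j+1}$. A jump partition is a pair $J=(\mu,\nu)$ of an inner and an outer jump partition, of size $|\mu|+|\nu|$. -}

module Defs where

open import Data.Nat using (ℕ; zero; suc; _+_; _∸_; _≡ᵇ_; _≥_; _<_)
open import Data.List using (List; []; _∷_; _++_; map; foldl; upTo; downFrom; length)
open import Data.List.Relation.Unary.All using (All)
open import Data.List.Relation.Unary.Linked using (Linked)
open import Data.Bool using (if_then_else_)
open import Relation.Binary.PropositionalEquality using (_≡_)
open import Relation.Nullary using (¬_)
open import Data.Product using (_×_)

-- Permutations of {1..n} are represented in one-line notation as lists of ℕ.

IsPartition : List ℕ → Set
IsPartition μ = Linked _≥_ μ × All (λ x → 0 < x) μ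

minPerm : ℕ → ℕ → List ℕ
minPerm c1 c2 = map suc (downFrom c1) ++ map (λ k → c1 + suc k) (downFrom c2)

-- σ · s_t : swap the entries at (1-based) positions t and t+1.
swapPos : ℕ → List ℕ → List ℕ
swapPos (suc zero) (x ∷ y ∷ xs) = y ∷ x ∷ xs
swapPos (suc (suc t)) (x ∷ xs) = x ∷ swapPos (suc t) xs
swapPos _ xs = xs

-- s_t · σ : swap the values t and t+1.
swapVal : ℕ → List ℕ → List ℕ
swapVal t = map (λ x → if x ≡ᵇ t then suc t else (if x ≡ᵇ suc t then t else x))

jumpWord : ℕ → ℕ → List ℕ → List ℕ
jumpWord c1 j [] = []
jumpWord c1 j (m ∷ ms) = map (λ i → (c1 ∸ j) + suc i) (upTo m) ++ jumpWord c1 (suc j) ms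

-- π ∘ μ = π · ∏_j (s_{c1-j+1} ⋯ s_{c1-j+μ_j}) : right multiplication acts
-- left to right, i.e. position swaps applied in the order of the word.
innerAct : ℕ → List ℕ → List ℕ → List ℕ
innerAct c1 π μ = foldl (λ σ t → swapPos t σ) π (jumpWord c1 1 μ)

-- ν ∘ π = F_ℓ ⋯ F_1 · π, F_j = s_{c1-j+ν_j} ⋯ s_{c1-j+1} : left multiplication,
-- rightmost factor first, i.e. value swaps s_{c1}, ..., s_{c1-1+ν_1}, then F_2, ...
outerAct : ℕ → List ℕ → List ℕ → List ℕ
outerAct c1 ν π = foldl (λ σ t → swapVal t σ) π (jumpWord c1 1 ν)

-- 1-based position of value v in σ (length σ + 1 if absent).
posOf : ℕ → List ℕ → ℕ
posOf v [] = 1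
posOf v (x ∷ xs) = if x ≡ᵇ v then 1 else suc (posOf v xs)

Moved : List ℕ → List ℕ → ℕ → Set
Moved π σ v = ¬ (posOf v σ ≡ posOf v π)

-- The word of a jump partition of size d uses only transpositions s_t with both t and t+1 in
-- (c1 − d, c1 + d].  Acting on positions, the inner word therefore only permutes the entries in
-- positions c1 − |μ| + 1, …, c1 + |μ| of π, whose values are 1, …, |μ| and the |μ| largest
-- values of the second block.  Acting on values, the outer word only moves the values in
-- (c1 − |ν|, c1 + |ν|].  When |μ| + |ν| ≤ c1 and |μ| + |ν| ≤ c2 these two sets of values are
-- disjoint.
module Submission where

open import Defs
open import Data.Nat using (ℕ; _+_; _≤_; _<_)
open import Data.List using (List; length)
open import Data.Nat.ListAction using (sum)
open import Data.List.Relation.Unary.All using (All)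
open import Data.Product using (_×_)
open import Data.Sum using (_⊎_)
open import Data.Empty using (⊥)
open import Relation.Binary.PropositionalEquality using (_≡_)

open import Data.Nat using (zero; suc; _∸_; _≡ᵇ_; z≤n; s≤s)
open import Data.Nat.Properties
open import Data.List using ([]; _∷_; _++_; map; foldl; downFrom)
open import Data.List.Properties using (map-++; ++-assoc; length-map; length-downFrom; length-++)
open import Data.List.Membership.Propositional using (_∈_; _∉_)
open import Data.List.Membership.Propositional.Properties using (∈-map⁻; ∈-++⁻; ∈-downFrom⁻)
open import Data.List.Membership.DecPropositional _≟_ using (_∈?_)
open import Data.List.Relation.Unary.Any using (here; there)
open import Data.List.Relation.Unary.All using ([]; _∷_)
open import Data.List.Relation.Unary.All.Properties using (++⁺; map⁺; applyUpTo⁺₁)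
open import Data.List.Relation.Binary.Permutation.Propositional using (_↭_; refl; prep; swap; ↭-trans)
open import Data.List.Relation.Binary.Permutation.Propositional.Properties using (↭-length; ∈-resp-↭)
open import Data.Product using (Σ; _,_; proj₁; proj₂)
open import Data.Sum using (inj₁; inj₂; [_,_]′)
open import Data.Bool using (true; false; if_then_else_)
open import Function using (_∘_)
open import Relation.Binary.PropositionalEquality
  using (_≢_; refl; sym; trans; cong; cong₂; ≢-sym; module ≡-Reasoning)
open import Relation.Nullary using (yes; no)
open import Relation.Nullary.Decidable using (dec-true; dec-false; decidable-stable)

≡ᵇ-refl : ∀ m → (m ≡ᵇ m) ≡ true
≡ᵇ-refl m = dec-true (m ≟ m) refl

≢⇒≡ᵇ≡false : ∀ {m n} → m ≢ n → (m ≡ᵇ n) ≡ false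
≢⇒≡ᵇ≡false {m} {n} = dec-false (m ≟ n)

posOf-++-∉ : ∀ {v} P S → v ∉ P → posOf v (P ++ S) ≡ length P + posOf v S
posOf-++-∉ [] S _ = refl
posOf-++-∉ (x ∷ P) S v∉
  rewrite ≢⇒≡ᵇ≡false (v∉ ∘ here ∘ sym) = cong suc (posOf-++-∉ P S (v∉ ∘ there))

posOf-middle : ∀ {v} P {X Y} S → v ∉ X → v ∉ Y → length X ≡ length Y →
  posOf v (P ++ X ++ S) ≡ posOf v (P ++ Y ++ S)
posOf-middle {v} [] {X} {Y} S v∉X v∉Y |X|≡|Y| = begin
  posOf v (X ++ S)         ≡⟨ posOf-++-∉ X S v∉X ⟩
  length X + posOf v S     ≡⟨ cong (_+ posOf v S) |X|≡|Y| ⟩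
  length Y + posOf v S     ≡⟨ posOf-++-∉ Y S v∉Y ⟨
  posOf v (Y ++ S)         ∎
  where open ≡-Reasoning
posOf-middle {v} (p ∷ P) S v∉X v∉Y |X|≡|Y| =
  cong (λ n → if p ≡ᵇ v then 1 else suc n) (posOf-middle P S v∉X v∉Y |X|≡|Y|)

Within : ℕ → ℕ → ℕ → Set
Within lo hi t = lo < t × suc t ≤ hi

swapPositions : List ℕ → List ℕ → List ℕ
swapPositions σ ts = foldl (λ σ t → swapPos t σ) σ ts

swapValues : List ℕ → List ℕ → List ℕ
swapValues σ ts = foldl (λ σ t → swapVal t σ) σ ts

swapPos-↭ : ∀ t xs → swapPos t xs ↭ xs
swapPos-↭ (suc zero) (x ∷ y ∷ xs) = swap y x refl
swapPos-↭ (suc (suc t)) (x ∷ xs) = prep x (swapPos-↭ (suc t) xs)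
swapPos-↭ zero xs = refl
swapPos-↭ (suc zero) [] = refl
swapPos-↭ (suc zero) (x ∷ []) = refl
swapPos-↭ (suc (suc t)) [] = refl

swapPositions-↭ : ∀ xs ts → swapPositions xs ts ↭ xs
swapPositions-↭ xs [] = refl
swapPositions-↭ xs (t ∷ ts) = ↭-trans (swapPositions-↭ (swapPos t xs) ts) (swapPos-↭ t xs)

swapPos-++ : ∀ {t} W S → 0 < t → suc t ≤ length W → swapPos t (W ++ S) ≡ swapPos t W ++ S
swapPos-++ {suc zero} (x ∷ y ∷ W) S _ _ = refl
swapPos-++ {suc (suc t)} (x ∷ W) S _ (s≤s t<|W|) = cong (x ∷_) (swapPos-++ W S (s≤s z≤n) t<|W|)
swapPos-++ {suc zero} (x ∷ []) S _ (s≤s ())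

swapPos-∷ : ∀ {t} x xs → 0 < t → swapPos (suc t) (x ∷ xs) ≡ x ∷ swapPos t xs
swapPos-∷ {suc t} x xs _ = refl

swapPos-shift : ∀ {t} P xs → 0 < t → swapPos (length P + t) (P ++ xs) ≡ P ++ swapPos t xs
swapPos-shift [] xs _ = refl
swapPos-shift {t} (p ∷ P) xs 0<t =
  trans (swapPos-∷ p (P ++ xs) (<-≤-trans 0<t (m≤n+m t (length P))))
        (cong (p ∷_) (swapPos-shift P xs 0<t))

swapPos-window : ∀ {t} P W S → Within (length P) (length P + length W) t →
  swapPos t (P ++ W ++ S) ≡ P ++ swapPos (t ∸ length P) W ++ S
swapPos-window {t} P W S (lo<t , t<hi) = begin
  swapPos t (P ++ W ++ S)                 ≡⟨ cong (λ u → swapPos u (P ++ W ++ S)) t≡lo+t′ ⟨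
  swapPos (length P + t′) (P ++ W ++ S)   ≡⟨ swapPos-shift P (W ++ S) 0<t′ ⟩
  P ++ swapPos t′ (W ++ S)                ≡⟨ cong (P ++_) (swapPos-++ W S 0<t′ t′<|W|) ⟩
  P ++ swapPos t′ W ++ S                  ∎
  where
  open ≡-Reasoning
  t′ = t ∸ length P
  t≡lo+t′ : length P + t′ ≡ t
  t≡lo+t′ = m+[n∸m]≡n (<⇒≤ lo<t)
  0<t′ : 0 < t′
  0<t′ = m<n⇒0<n∸m lo<t
  t′<|W| : suc t′ ≤ length W
  t′<|W| = +-cancelˡ-≤ (length P) (suc t′) (length W)
    (≤-trans (≤-reflexive (trans (+-suc (length P) t′) (cong suc t≡lo+t′))) t<hi)

swapPositions-window : ∀ P W S {n ts} → length W ≡ n → All (Within (length P) (length P + n)) ts →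
  swapPositions (P ++ W ++ S) ts ≡ P ++ swapPositions W (map (_∸ length P) ts) ++ S
swapPositions-window P W S refl [] = refl
swapPositions-window P W S {ts = t ∷ ts} refl (w ∷ ws) =
  trans (cong (λ σ → swapPositions σ ts) (swapPos-window P W S w))
        (swapPositions-window P (swapPos (t ∸ length P) W) S
          (↭-length (swapPos-↭ (t ∸ length P) W)) ws)

record Segment (σ : List ℕ) (lo hi : ℕ) : Set where
  field
    before middle after : List ℕ
    split : σ ≡ before ++ middle ++ after
    length-before : length before ≡ lo
    length-through : length before + length middle ≡ hi

open Segment using (middle)

posOf-swapPositions-outside : ∀ {σ lo hi ts v} (seg : Segment σ lo hi) → All (Within lo hi) ts →
  v ∉ middle seg → posOf v (swapPositions σ ts) ≡ posOf v σ
posOf-swapPositions-outside {ts = ts} {v}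
  record { before = P ; middle = W ; after = S ; split = refl ; length-before = refl ; length-through = refl }
  ws v∉W = begin
    posOf v (swapPositions (P ++ W ++ S) ts)   ≡⟨ cong (posOf v) (swapPositions-window P W S refl ws) ⟩
    posOf v (P ++ W′ ++ S)                     ≡⟨ posOf-middle P S (v∉W ∘ ∈-resp-↭ W′↭W) v∉W (↭-length W′↭W) ⟩
    posOf v (P ++ W ++ S)                      ∎
  where
  open ≡-Reasoning
  W′ = swapPositions W (map (_∸ length P) ts)
  W′↭W : W′ ↭ W
  W′↭W = swapPositions-↭ W (map (_∸ length P) ts)

transpose : ℕ → ℕ → ℕ
transpose t x = if x ≡ᵇ t then suc t else (if x ≡ᵇ suc t then t else x)

transpose-≡ᵇ : ∀ {v t} x → v ≢ t → v ≢ suc t → (transpose t x ≡ᵇ v) ≡ (x ≡ᵇ v)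
transpose-≡ᵇ {v} {t} x v≢t v≢1+t with x ≟ t
... | yes refl rewrite ≡ᵇ-refl x =
  trans (≢⇒≡ᵇ≡false (≢-sym v≢1+t)) (sym (≢⇒≡ᵇ≡false (≢-sym v≢t)))
... | no x≢t rewrite ≢⇒≡ᵇ≡false x≢t with x ≟ suc t
...   | yes refl rewrite ≡ᵇ-refl t =
  trans (≢⇒≡ᵇ≡false (≢-sym v≢t)) (sym (≢⇒≡ᵇ≡false (≢-sym v≢1+t)))
...   | no x≢1+t rewrite ≢⇒≡ᵇ≡false x≢1+t = refl

posOf-map : ∀ {v} f → (∀ x → (f x ≡ᵇ v) ≡ (x ≡ᵇ v)) → ∀ σ → posOf v (map f σ) ≡ posOf v σ
posOf-map f f-fixes [] = refl
posOf-map {v} f f-fixes (x ∷ σ)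
  rewrite f-fixes x = cong (λ n → if x ≡ᵇ v then 1 else suc n) (posOf-map f f-fixes σ)

outside-≢ : ∀ {lo hi v t} → v ≤ lo ⊎ hi < v → Within lo hi t → v ≢ t × v ≢ suc t
outside-≢ (inj₁ v≤lo) (lo<t , _) =
  (λ { refl → <-irrefl refl (≤-<-trans v≤lo lo<t) }) ,
  (λ { refl → <-asym (≤-<-trans v≤lo lo<t) (n<1+n _) })
outside-≢ (inj₂ hi<v) (_ , t<hi) =
  (λ { refl → <-asym (<-≤-trans (n<1+n _) t<hi) hi<v }) ,
  (λ { refl → <-irrefl refl (<-≤-trans hi<v t<hi) })

posOf-swapValues-outside : ∀ {lo hi ts v} σ → v ≤ lo ⊎ hi < v → All (Within lo hi) ts →
  posOf v (swapValues σ ts) ≡ posOf v σ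
posOf-swapValues-outside σ out [] = refl
posOf-swapValues-outside {ts = t ∷ _} σ out (w ∷ ws) =
  trans (posOf-swapValues-outside (swapVal t σ) out ws)
        (posOf-map (transpose t) (λ x → transpose-≡ᵇ x v≢t v≢1+t) σ)
  where
  v≢t = proj₁ (outside-≢ out w)
  v≢1+t = proj₂ (outside-≢ out w)

jumpRow-within : ∀ {c1 d k m i} → 0 < m → k + m ≤ d → d ≤ c1 → i < m →
  Within (c1 ∸ d) (c1 + d) ((c1 ∸ suc k) + suc i)
jumpRow-within {c1} {d} {k} {m} {i} 0<m k+m≤d d≤c1 i<m = lower , upper
  where
  open ≤-Reasoning
  1+k≤d : suc k ≤ d
  1+k≤d = ≤-trans (≤-trans (≤-reflexive (+-comm 1 k)) (+-monoʳ-≤ k 0<m)) k+m≤d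
  lower : c1 ∸ d < (c1 ∸ suc k) + suc i
  lower = ≤-<-trans (∸-monoʳ-≤ c1 1+k≤d) (m<m+n (c1 ∸ suc k) (s≤s z≤n))
  upper : suc ((c1 ∸ suc k) + suc i) ≤ c1 + d
  upper = begin
    suc ((c1 ∸ suc k) + suc i)   ≡⟨ +-suc (c1 ∸ suc k) (suc i) ⟨
    (c1 ∸ suc k) + suc (suc i)   ≤⟨ +-monoʳ-≤ (c1 ∸ suc k) (s≤s (≤-trans i<m (m≤n+m m k))) ⟩
    (c1 ∸ suc k) + (suc k + m)   ≡⟨ +-assoc (c1 ∸ suc k) (suc k) m ⟨
    (c1 ∸ suc k) + suc k + m     ≡⟨ cong (_+ m) (m∸n+n≡m (≤-trans 1+k≤d d≤c1)) ⟩
    c1 + m                       ≤⟨ +-monoʳ-≤ c1 (m+n≤o⇒n≤o k k+m≤d) ⟩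
    c1 + d                       ∎

jumpWord-within : ∀ {c1 d} k μ → All (0 <_) μ → k + sum μ ≤ d → d ≤ c1 →
  All (Within (c1 ∸ d) (c1 + d)) (jumpWord c1 (suc k) μ)
jumpWord-within k [] [] _ _ = []
jumpWord-within {d = d} k (m ∷ μ) (0<m ∷ μ⁺) k+Σ≤d d≤c1 =
  ++⁺ (map⁺ (applyUpTo⁺₁ _ m (jumpRow-within 0<m k+m≤d d≤c1)))
      (jumpWord-within (suc k) μ μ⁺ 1+k+Σμ≤d d≤c1)
  where
  k+m≤d : k + m ≤ d
  k+m≤d = ≤-trans (+-monoʳ-≤ k (m≤m+n m (sum μ))) k+Σ≤d
  1+k+Σμ≤d : suc k + sum μ ≤ d
  1+k+Σμ≤d = ≤-trans (≤-trans (≤-reflexive (sym (+-suc k (sum μ))))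
                               (+-monoʳ-≤ k (+-monoˡ-≤ (sum μ) 0<m))) k+Σ≤d

downFrom-+ : ∀ m n → downFrom (m + n) ≡ map (n +_) (downFrom m) ++ downFrom n
downFrom-+ zero n = refl
downFrom-+ (suc m) n = cong₂ _∷_ (+-comm m n) (downFrom-+ m n)

length-map-downFrom : ∀ (f : ℕ → ℕ) n → length (map f (downFrom n)) ≡ n
length-map-downFrom f n = trans (length-map f (downFrom n)) (length-downFrom n)

minPerm-segment′ : ∀ x a y → Σ (Segment (minPerm (x + a) (a + y)) x (x + a + a))
  λ seg → ∀ {v} → v ∈ middle seg → v ≤ a ⊎ x + a + y < v
minPerm-segment′ x a y = segment , classify
  where
  g : ℕ → ℕ
  g k = x + a + suc k
  P = map suc (map (a +_) (downFrom x))
  W₁ = map suc (downFrom a)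
  W₂ = map g (map (y +_) (downFrom a))
  S = map g (downFrom y)

  split : minPerm (x + a) (a + y) ≡ P ++ (W₁ ++ W₂) ++ S
  split = begin
    map suc (downFrom (x + a)) ++ map g (downFrom (a + y))
      ≡⟨ cong₂ (λ u w → map suc u ++ map g w) (downFrom-+ x a) (downFrom-+ a y) ⟩
    map suc (map (a +_) (downFrom x) ++ downFrom a) ++ map g (map (y +_) (downFrom a) ++ downFrom y)
      ≡⟨ cong₂ _++_ (map-++ suc (map (a +_) (downFrom x)) (downFrom a))
                    (map-++ g (map (y +_) (downFrom a)) (downFrom y)) ⟩
    (P ++ W₁) ++ (W₂ ++ S)   ≡⟨ ++-assoc P W₁ (W₂ ++ S) ⟩
    P ++ W₁ ++ W₂ ++ S       ≡⟨ cong (P ++_) (++-assoc W₁ W₂ S) ⟨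
    P ++ (W₁ ++ W₂) ++ S     ∎
    where open ≡-Reasoning

  |P| : length P ≡ x
  |P| = trans (length-map suc (map (a +_) (downFrom x))) (length-map-downFrom (a +_) x)

  |W| : length (W₁ ++ W₂) ≡ a + a
  |W| = trans (length-++ W₁) (cong₂ _+_ (length-map-downFrom suc a)
          (trans (length-map g (map (y +_) (downFrom a))) (length-map-downFrom (y +_) a)))

  segment : Segment (minPerm (x + a) (a + y)) x (x + a + a)
  segment = record
    { before = P ; middle = W₁ ++ W₂ ; after = S
    ; split = split
    ; length-before = |P|
    ; length-through = trans (cong₂ _+_ |P| |W|) (sym (+-assoc x a a))
    }

  classify : ∀ {v} → v ∈ W₁ ++ W₂ → v ≤ a ⊎ x + a + y < v
  classify v∈W with ∈-++⁻ W₁ v∈W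
  ... | inj₁ v∈W₁ with ∈-map⁻ suc v∈W₁
  ...   | k , k∈ , refl = inj₁ (∈-downFrom⁻ k∈)
  classify v∈W | inj₂ v∈W₂ with ∈-map⁻ g v∈W₂
  ...   | _ , k∈ , refl with ∈-map⁻ (y +_) k∈
  ...     | k , _ , refl = inj₂ (+-monoʳ-< (x + a) (s≤s (m≤m+n y k)))

minPerm-segment : ∀ {a c1 c2} → a ≤ c1 → a ≤ c2 → Σ (Segment (minPerm c1 c2) (c1 ∸ a) (c1 + a))
  λ seg → ∀ {v} → v ∈ middle seg → v ≤ a ⊎ c1 + (c2 ∸ a) < v
minPerm-segment {a} a≤c1 a≤c2 with m≤n⇒∃[o]m+o≡n a≤c1 | m≤n⇒∃[o]m+o≡n a≤c2
... | x , refl | y , refl rewrite m+n∸m≡n a x | m+n∸m≡n a y | +-comm a x = minPerm-segment′ x a y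

jump-moves-disjoint : ∀ c1 c2 μ ν → All (0 <_) μ → All (0 <_) ν →
  sum μ + sum ν ≤ c1 → sum μ + sum ν ≤ c2 → (v : ℕ) →
  Moved (minPerm c1 c2) (innerAct c1 (minPerm c1 c2) μ) v →
  Moved (minPerm c1 c2) (outerAct c1 ν (minPerm c1 c2)) v → ⊥
jump-moves-disjoint c1 c2 μ ν μ⁺ ν⁺ Δ≤c1 Δ≤c2 v moved-inner moved-outer =
  moved-outer (posOf-swapValues-outside (minPerm c1 c2) v-outside (jumpWord-within 0 ν ν⁺ ≤-refl b≤c1))
  where
  a = sum μ
  b = sum ν
  a≤c1 = m+n≤o⇒m≤o a Δ≤c1
  b≤c1 = m+n≤o⇒n≤o a Δ≤c1
  window = minPerm-segment a≤c1 (m+n≤o⇒m≤o a Δ≤c2)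
  seg = proj₁ window

  v∈W : v ∈ middle seg
  v∈W = decidable-stable (v ∈? middle seg)
          (moved-inner ∘ posOf-swapPositions-outside seg (jumpWord-within 0 μ μ⁺ ≤-refl a≤c1))

  v-outside : v ≤ c1 ∸ b ⊎ c1 + b < v
  v-outside = [ (λ v≤a → inj₁ (≤-trans v≤a (m+n≤o⇒m≤o∸n a Δ≤c1)))
              , (λ c1+[c2∸a]<v → inj₂ (≤-<-trans (+-monoʳ-≤ c1 b≤c2∸a) c1+[c2∸a]<v))
              ]′ (proj₂ window v∈W)
    where
    b≤c2∸a : b ≤ c2 ∸ a
    b≤c2∸a = m+n≤o⇒m≤o∸n b (≤-trans (≤-reflexive (+-comm b a)) Δ≤c2)

shape-≤ : ∀ {s r c1 c2} → r ≤ s → (c1 ≡ s × c2 ≡ r) ⊎ (c1 ≡ r × c2 ≡ s) → r ≤ c1 × r ≤ c2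
shape-≤ r≤s (inj₁ (refl , refl)) = r≤s , ≤-refl
shape-≤ r≤s (inj₂ (refl , refl)) = ≤-refl , r≤s

-- Only positivity of the parts and |μ| + |ν| ≤ min(c1, c2) are needed.
lemma17 : (s r : ℕ) → r ≤ s → 1 ≤ r →
    (c1 c2 : ℕ) → ((c1 ≡ s × c2 ≡ r) ⊎ (c1 ≡ r × c2 ≡ s)) →
    (μ ν : List ℕ) →
    IsPartition μ → length μ ≤ c1 → All (λ x → x < c2) μ →
    IsPartition ν → length ν ≤ c1 → All (λ x → x < c2) ν →
    sum μ + sum ν < r →
    (v : ℕ) →
    Moved (minPerm c1 c2) (innerAct c1 (minPerm c1 c2) μ) v →
    Moved (minPerm c1 c2) (outerAct c1 ν (minPerm c1 c2)) v → ⊥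
lemma17 s r r≤s _ c1 c2 shape μ ν (_ , μ⁺) _ _ (_ , ν⁺) _ _ Δ<r =
  jump-moves-disjoint c1 c2 μ ν μ⁺ ν⁺ (≤-trans (<⇒≤ Δ<r) r≤c1) (≤-trans (<⇒≤ Δ<r) r≤c2)
  where
  r≤c1 = proj₁ (shape-≤ r≤s shape)
  r≤c2 = proj₂ (shape-≤ r≤s shape)
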